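{- Let $n\ge 1$, let $\mathcal{M}$ be a polytopal maniplex of rank $n$, let $F$ be a facet of $\mathcal{M}$, and let $G_n$ be a facet (face of rank $n$) of the $(n+1)$-maniplex $\mathcal{M}^F$. Then the section $G_n/G_{ -1}$ of the poset $\mathrm{Pos}(\mathcal{M}^F)$, where $G_{ -1}$ is its least element, satisfies the diamond condition.
   Context: An $n$-maniplex is a connected simple graph whose vertices (flags) have edges properly coloured with colours $0,\dots,n-1$, each flag on exactly one edge of each colour, such that for $|i-j|>1$ the $i$- and $j$-edges form alternating $4$-cycles. $r_i$ maps each flag to its $i$-neighbour. For $0\le i\le n-1$, the $i$-face $\mathcal{M}_{\bar i}(\Phi)$ is the connected component containing $\Phi$ of the graph obtained by deleting all $i$-edges; facets are $(n-1)$-faces. $\mathrm{Pos}(\mathcal{M})$ consists of all $i$-faces ($0\le i\le n-1$, rank $i$) plus a least element of rank $-1$ and greatest element of rank $n$; faces of ranks $i\le j$ satisfy $F_i\le F_j$ iff they share a flag. A section $G/H$ is $\{K:H\le K\le G\}$. Diamond condition: whenever $H<G$ with ranks differing by $2$, exactly two $K$ satisfy $H<K<G$. A chain is maximal if not properly contained in another chain; two maximal chains are adjacent if they differ in exactly one element; a poset is flag-connected if any two maximal chains are joined by a sequence of maximal chains with consecutive ones adjacent; it is strongly flag-connected if every section $G/H$ with $H\le G$ is flag-connected. $\mathcal{M}$ is polytopal if $\mathrm{Pos}(\mathcal{M})$ is an abstract polytope, i.e. satisfies the diamond condition and is strongly flag-connected. Given a facet $F$ of $\mathcal{M}$, $\mathcal{M}^F$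 has flags $(\Phi,x)$, $\Phi$ a flag of $\mathcal{M}$, $x\in\mathbb{Z}_2^2$, with $i$-edges joining $(\Phi,x)$ to $s_i(\Phi,x)$, where $s_i(\Phi,x)=(r_i\Phi,x)$ for $i\le n-1$, $s_n(\Phi,x)=(\Phi,x+(1,0))$ if $\Phi\notin F$, $s_n(\Phi,x)=(\Phi,x+(1,1))$ if $\Phi\in F$; $\mathrm{Pos}(\mathcal{M}^F)$ is defined analogously with ranks $-1,\dots,n+1$. -}

module Defs where

open import Level using (Level) renaming (suc to lsuc; zero to lzero)
open import Data.Nat using (ℕ; zero; suc; _≤_; _<_; _+_)
open import Data.Fin using (Fin; zero; suc; toℕ; fromℕ)
open import Data.Bool using (Bool; not)
open import Data.Product using (Σ; _×_; _,_; ∃; Σ-syntax)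
open import Data.Sum using (_⊎_)
open import Data.Unit using (⊤)
open import Data.Empty using (⊥)
open import Data.Maybe using (Maybe; just; nothing)
open import Relation.Nullary using (¬_)
open import Relation.Binary.PropositionalEquality using (_≡_; _≢_)

-- Generic (pre)order-theoretic notions on a carrier X with an
-- equality _≈_ (faces are sets of flags, so equality is extensional),
-- an order _≤_ and a rank function rk.

module PosetNotions {X : Set} (_≈_ : X → X → Set) (_≤_ : X → X → Set)
                    (rk : X → ℕ) where

  _⊏_ : X → X → Set
  x ⊏ y = (x ≤ y) × ¬ (x ≈ y)

  Subset : Set₁
  Subset = X → Set

  _⊆_ : Subset → Subset → Set
  A ⊆ B = ∀ x → A x → B x

  Section : X → X → Subset
  Section G H K = (H ≤ K) × (K ≤ G)

  ExactlyTwo : (X → Set) → Set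
  ExactlyTwo P = Σ[ K₁ ∈ X ] Σ[ K₂ ∈ X ]
    (P K₁ × P K₂ × ¬ (K₁ ≈ K₂) × (∀ K → P K → (K ≈ K₁) ⊎ (K ≈ K₂)))

  Diamond : Subset → Set
  Diamond S = ∀ H G → S H → S G → H ⊏ G → rk G ≡ 2 + rk H →
              ExactlyTwo (λ K → S K × H ⊏ K × K ⊏ G)

  Chain : Subset → Subset → Set
  Chain S C = (C ⊆ S) × (∀ x y → x ≈ y → C x → C y)
            × (∀ x y → C x → C y → (x ≤ y) ⊎ (y ≤ x))

  MaxChain : Subset → Subset → Set₁
  MaxChain S C = Chain S C ×
    (∀ D → Chain S D → C ⊆ D → ¬ (Σ[ x ∈ X ] (D x × ¬ C x)))

  Adjacent : Subset → Subset → Set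
  Adjacent C D = Σ[ x ∈ X ] Σ[ y ∈ X ]
    (C x × ¬ D x × D y × ¬ C y
     × (∀ z → C z → ¬ D z → z ≈ x)
     × (∀ z → D z → ¬ C z → z ≈ y))

  data FlagPath (S : Subset) : Subset → Subset → Set₁ where
    done : ∀ {C D} → C ⊆ D → D ⊆ C → FlagPath S C D
    step : ∀ {C C' D} → MaxChain S C' → Adjacent C C' →
           FlagPath S C' D → FlagPath S C D

  FlagConnected : Subset → Set₁
  FlagConnected S = ∀ C D → MaxChain S C → MaxChain S D → FlagPath S C D

  StronglyFlagConnected : Set₁
  StronglyFlagConnected = ∀ G H → H ≤ G → FlagConnected (Section G H)

  Whole : Subset
  Whole _ = ⊤

data Reach {m : ℕ} {Flag : Set} (E : Fin m → Flag → Flag → Set)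
           (k : Fin m) : Flag → Flag → Set where
  here  : ∀ {Φ} → Reach E k Φ Φ
  step  : ∀ {Φ Ψ Χ} (j : Fin m) → j ≢ k → E j Φ Ψ → Reach E k Ψ Χ →
          Reach E k Φ Χ

data Conn {m : ℕ} {Flag : Set} (E : Fin m → Flag → Flag → Set)
          : Flag → Flag → Set where
  here  : ∀ {Φ} → Conn E Φ Φ
  step  : ∀ {Φ Ψ Χ} (j : Fin m) → E j Φ Ψ → Conn E Ψ Χ → Conn E Φ Χ

-- Elements of Pos: least element (rank -1), the i-face of a flag
-- (rank i, 0 ≤ i ≤ m-1), greatest element (rank m).
data Face (m : ℕ) (Flag : Set) : Set where
  ⊥F   : Face m Flag
  face : Fin m → Flag → Face m Flag
  ⊤F   : Face m Flag

-- rank shifted by one (rank -1 ↦ 0)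
rk : ∀ {m Flag} → Face m Flag → ℕ
rk ⊥F = 0
rk (face i _) = suc (toℕ i)
rk {m} ⊤F = suc m

module _ {m : ℕ} {Flag : Set} (E : Fin m → Flag → Flag → Set) where

  -- equality of faces: same rank and same set of flags
  FaceEq : Face m Flag → Face m Flag → Set
  FaceEq ⊥F ⊥F = ⊤
  FaceEq (face i Φ) (face j Ψ) = (i ≡ j) × Reach E i Φ Ψ
  FaceEq ⊤F ⊤F = ⊤
  FaceEq _ _ = ⊥

  FaceLe : Face m Flag → Face m Flag → Set
  FaceLe ⊥F _ = ⊤
  FaceLe _ ⊤F = ⊤
  FaceLe (face i Φ) (face j Ψ) =
    (toℕ i ≤ toℕ j) × (Σ[ Χ ∈ Flag ] (Reach E i Φ Χ × Reach E j Ψ Χ))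
  FaceLe _ _ = ⊥

  module Pos = PosetNotions FaceEq FaceLe rk

  Polytopal : Set₁
  Polytopal = Pos.Diamond Pos.Whole × Pos.StronglyFlagConnected

EdgeOf : ∀ {n} {Flag : Set} → (Fin n → Flag → Flag) → Fin n → Flag → Flag → Set
EdgeOf r i Φ Ψ = r i Φ ≡ Ψ

record IsManiplex (n : ℕ) (Flag : Set) (r : Fin n → Flag → Flag) : Set where
  field
    involutive  : ∀ i Φ → r i (r i Φ) ≡ Φ
    noLoops     : ∀ i Φ → r i Φ ≢ Φ
    simple      : ∀ i j Φ → i ≢ j → r i Φ ≢ r j Φ
    commute     : ∀ i j Φ → suc (toℕ i) < toℕ j → r i (r j Φ) ≡ r j (r i Φ)
    connected   : ∀ Φ Ψ → Conn (EdgeOf r) Φ Ψ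

Z2² : Set
Z2² = Bool × Bool

_+10 : Z2² → Z2²
(a , b) +10 = (not a , b)

_+11 : Z2² → Z2²
(a , b) +11 = (not a , not b)

splitLast : (n : ℕ) → Fin (suc n) → Maybe (Fin n)
splitLast zero    zero    = nothing
splitLast (suc n) zero    = just zero
splitLast (suc n) (suc i) = Data.Maybe.map suc (splitLast n i)

-- M has rank n = suc k; facet F = (n-1)-face of flag Φ₀.
InFacet : ∀ {k} {Flag : Set} → (Fin (suc k) → Flag → Flag) → Flag → Flag → Set
InFacet {k} r Φ₀ Φ = Reach (EdgeOf r) (fromℕ k) Φ₀ Φ

MFEdge : (n : ℕ) {Flag : Set} → (Fin n → Flag → Flag) → (Flag → Set) →
         Fin (suc n) → Flag × Z2² → Flag × Z2² → Set
MFEdge n r inF i (Φ , x) (Ψ , y) with splitLast n i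
... | just j  = (Ψ ≡ r j Φ) × (y ≡ x)
... | nothing = (Ψ ≡ Φ) × ((¬ inF Φ × y ≡ x +10) ⊎ (inF Φ × y ≡ x +11))

{-# OPTIONS --safe #-}
module Submission where

-- The facet G of M^F through a flag (Ψ , x₀) consists of the flags (Φ , x₀): the
-- n-face of a flag of M^F never changes the Z₂² coordinate, and its colours
-- below n act on M alone.  Projecting a face of M^F of colour c < n to the
-- c-face of its first coordinate, and G itself to the greatest face, is
-- therefore a rank-preserving order isomorphism from G/G₋₁ onto Pos(M), so
-- the diamond condition of Pos(M) transfers to G/G₋₁.

open import Defs
open import Data.Nat using (ℕ; zero; suc; _+_; _≤_)
import Data.Nat.Properties as ℕ
open import Data.Fin using (Fin; fromℕ; inject₁; toℕ)
open import Data.Fin.Properties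
  using (fromℕ≢inject₁; inject₁-injective; inject₁ℕ<; toℕ-inject₁; toℕ-fromℕ; ≤fromℕ)
open import Data.Fin.Relation.Unary.Top
  using (View; view; ‵fromℕ; ‵inject₁; view-fromℕ; view-inject₁)
open import Data.Bool.Properties using (not-involutive)
open import Data.Product using (Σ; _×_; _,_; proj₁; proj₂)
open import Data.Sum using (_⊎_; inj₁; inj₂)
import Data.Sum as Sum
open import Data.Unit using (tt)
open import Data.Empty using (⊥-elim)
open import Data.Maybe using (just; nothing)
open import Function using (id; _∘_)
open import Relation.Nullary using (¬_)
open import Relation.Binary.PropositionalEquality

module _ {m : ℕ} {A : Set} {E : Fin m → A → A → Set} where

  Reach-trans : ∀ {c a b d} → Reach E c a b → Reach E c b d → Reach E c a d
  Reach-trans here             q = q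
  Reach-trans (step j j≢c e p) q = step j j≢c e (Reach-trans p q)

  Reach-sym : (∀ j {a b} → E j a b → E j b a) →
              ∀ {c a b} → Reach E c a b → Reach E c b a
  Reach-sym E-sym here             = here
  Reach-sym E-sym (step j j≢c e p) =
    Reach-trans (Reach-sym E-sym p) (step j j≢c (E-sym j e) here)

module DiamondTransfer {X Y : Set}
  (_≈X_ _≤X_ : X → X → Set) (rkX : X → ℕ)
  (_≈Y_ _≤Y_ : Y → Y → Set) (rkY : Y → ℕ) where

  private
    module PX = PosetNotions _≈X_ _≤X_ rkX
    module PY = PosetNotions _≈Y_ _≤Y_ rkY

  record RankedIsoOnto (S : PX.Subset) : Set where
    field
      π            : X → Y
      lift         : Y → X
      lift-∈       : ∀ y → S (lift y)
      π∘lift       : ∀ y → π (lift y) ≡ y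
      π-≈          : ∀ {a b} → a ≈X b → π a ≈Y π b
      π-≤          : ∀ {a b} → a ≤X b → π a ≤Y π b
      π-reflects-≈ : ∀ {a b} → S a → S b → π a ≈Y π b → a ≈X b
      π-reflects-≤ : ∀ {a b} → S a → S b → π a ≤Y π b → a ≤X b
      π-rank       : ∀ {a} → S a → rkY (π a) ≡ rkX a

  module _ {S : PX.Subset} (iso : RankedIsoOnto S) where
    open RankedIsoOnto iso

    π-⊏ : ∀ {a b} → S a → S b → a PX.⊏ b → π a PY.⊏ π b
    π-⊏ sa sb (a≤b , a≉b) = π-≤ a≤b , a≉b ∘ π-reflects-≈ sa sb

    π-reflects-⊏ : ∀ {a b} → S a → S b → π a PY.⊏ π b → a PX.⊏ b
    π-reflects-⊏ sa sb (πa≤πb , πa≉πb) = π-reflects-≤ sa sb πa≤πb , πa≉πb ∘ π-≈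

    diamond-transfer : PY.Diamond PY.Whole → PX.Diamond S
    diamond-transfer diamondY H K sH sK H⊏K rkK
      with diamondY (π H) (π K) tt tt (π-⊏ sH sK H⊏K)
                    (trans (π-rank sK) (trans rkK (cong (2 +_) (sym (π-rank sH)))))
    ... | A , B , (_ , H⊏A , A⊏K) , (_ , H⊏B , B⊏K) , A≉B , unique =
      lift A , lift B , between H⊏A A⊏K , between H⊏B B⊏K ,
      (λ e → A≉B (subst₂ _≈Y_ (π∘lift A) (π∘lift B) (π-≈ e))) ,
      λ L (sL , H⊏L , L⊏K) →
        Sum.map (towards-lift sL) (towards-lift sL)
                (unique (π L) (tt , π-⊏ sH sL H⊏L , π-⊏ sL sK L⊏K))
      where
      towards-lift : ∀ {L C} → S L → π L ≈Y C → L ≈X lift C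
      towards-lift {L} {C} sL e =
        π-reflects-≈ sL (lift-∈ C) (subst (π L ≈Y_) (sym (π∘lift C)) e)

      between : ∀ {C} → π H PY.⊏ C → C PY.⊏ π K →
                S (lift C) × H PX.⊏ lift C × lift C PX.⊏ K
      between {C} H⊏C C⊏K =
        lift-∈ C ,
        π-reflects-⊏ sH (lift-∈ C) (subst (π H PY.⊏_) (sym (π∘lift C)) H⊏C) ,
        π-reflects-⊏ (lift-∈ C) sK (subst (PY._⊏ π K) (sym (π∘lift C)) C⊏K)

splitLast-inject₁ : ∀ n (j : Fin n) → splitLast n (inject₁ j) ≡ just j
splitLast-inject₁ (suc n) Fin.zero    = refl
splitLast-inject₁ (suc n) (Fin.suc j) rewrite splitLast-inject₁ n j = refl

splitLast-fromℕ : ∀ n → splitLast n (fromℕ n) ≡ nothing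
splitLast-fromℕ zero    = refl
splitLast-fromℕ (suc n) rewrite splitLast-fromℕ n = refl

+10-involutive : ∀ x → (x +10) +10 ≡ x
+10-involutive (a , b) = cong (_, b) (not-involutive a)

+11-involutive : ∀ x → (x +11) +11 ≡ x
+11-involutive (a , b) = cong₂ _,_ (not-involutive a) (not-involutive b)

module FlagGraphMF {n : ℕ} {Flag : Set} (r : Fin n → Flag → Flag)
                   (r-involutive : ∀ i Φ → r i (r i Φ) ≡ Φ)
                   (r-connected : ∀ Φ Ψ → Conn (EdgeOf r) Φ Ψ)
                   (inF : Flag → Set) where

  M : Fin n → Flag → Flag → Set
  M = EdgeOf r

  E : Fin (suc n) → Flag × Z2² → Flag × Z2² → Set
  E = MFEdge n r inF

  MFEdge-inject₁ : ∀ j {Φ x Ψ y} →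
    E (inject₁ j) (Φ , x) (Ψ , y) ≡ ((Ψ ≡ r j Φ) × (y ≡ x))
  MFEdge-inject₁ j rewrite splitLast-inject₁ n j = refl

  MFEdge-fromℕ : ∀ {Φ x Ψ y} →
    E (fromℕ n) (Φ , x) (Ψ , y) ≡
      ((Ψ ≡ Φ) × ((¬ inF Φ × y ≡ x +10) ⊎ (inF Φ × y ≡ x +11)))
  MFEdge-fromℕ rewrite splitLast-fromℕ n = refl

  E-sym : ∀ c {a b} → E c a b → E c b a
  E-sym c {Φ , x} {Ψ , y} e with view c
  ... | ‵inject₁ j with subst id (MFEdge-inject₁ j) e
  ...   | refl , refl = subst id (sym (MFEdge-inject₁ j)) (sym (r-involutive j Φ) , refl)
  E-sym c {Φ , x} {Ψ , y} e | ‵fromℕ with subst id MFEdge-fromℕ e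
  ...   | refl , inj₁ (Φ∉F , refl) =
    subst id (sym MFEdge-fromℕ) (refl , inj₁ (Φ∉F , sym (+10-involutive x)))
  ...   | refl , inj₂ (Φ∈F , refl) =
    subst id (sym MFEdge-fromℕ) (refl , inj₂ (Φ∈F , sym (+11-involutive x)))

  E-proj : ∀ {j} c {a b} → c ≢ inject₁ j → E c a b → Reach M j (proj₁ a) (proj₁ b)
  E-proj c {Φ , x} {Ψ , y} c≢j e with view c
  ... | ‵inject₁ l with subst id (MFEdge-inject₁ l) e
  ...   | refl , _ = step l (c≢j ∘ cong inject₁) refl here
  E-proj c {Φ , x} {Ψ , y} c≢j e | ‵fromℕ with subst id MFEdge-fromℕ e
  ...   | refl , _ = here

  Reach-proj : ∀ {j a b} → Reach E (inject₁ j) a b → Reach M j (proj₁ a) (proj₁ b)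
  Reach-proj here             = here
  Reach-proj (step c c≢j e p) = Reach-trans (E-proj c c≢j e) (Reach-proj p)

  E-keeps-Z2 : ∀ c {a b} → c ≢ fromℕ n → E c a b → proj₂ b ≡ proj₂ a
  E-keeps-Z2 c {Φ , x} {Ψ , y} c≢n e with view c
  ... | ‵inject₁ l = proj₂ (subst id (MFEdge-inject₁ l) e)
  ... | ‵fromℕ     = ⊥-elim (c≢n refl)

  Reach-fromℕ-keeps-Z2 : ∀ {a b} → Reach E (fromℕ n) a b → proj₂ b ≡ proj₂ a
  Reach-fromℕ-keeps-Z2 here             = refl
  Reach-fromℕ-keeps-Z2 (step c c≢n e p) =
    trans (Reach-fromℕ-keeps-Z2 p) (E-keeps-Z2 c c≢n e)

  E-lift : ∀ {l Φ Ψ} x → M l Φ Ψ → E (inject₁ l) (Φ , x) (Ψ , x)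
  E-lift {l} x e = subst id (sym (MFEdge-inject₁ l)) (sym e , refl)

  Reach-lift : ∀ {j Φ Ψ} x → Reach M j Φ Ψ → Reach E (inject₁ j) (Φ , x) (Ψ , x)
  Reach-lift x here             = here
  Reach-lift x (step l l≢j e p) =
    step (inject₁ l) (l≢j ∘ inject₁-injective) (E-lift x e) (Reach-lift x p)

  Conn-lift : ∀ {Φ Ψ} x → Conn M Φ Ψ → Reach E (fromℕ n) (Φ , x) (Ψ , x)
  Conn-lift x here         = here
  Conn-lift x (step l e p) =
    step (inject₁ l) (fromℕ≢inject₁ ∘ sym) (E-lift x e) (Conn-lift x p)

  reanchor-inject₁ : ∀ {j a χ Ψ x} → Reach E (inject₁ j) a (χ , x) →
                     Reach M j (proj₁ a) Ψ → Reach E (inject₁ j) a (Ψ , x)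
  reanchor-inject₁ {x = x} p q =
    Reach-trans p (Reach-lift x (Reach-trans (Reach-sym M-sym (Reach-proj p)) q))
    where
    M-sym : ∀ l {Φ Ψ} → M l Φ Ψ → M l Ψ Φ
    M-sym l {Φ} refl = r-involutive l Φ

  reanchor-fromℕ : ∀ {a χ x} → Reach E (fromℕ n) a (χ , x) →
                   ∀ Ψ → Reach E (fromℕ n) a (Ψ , x)
  reanchor-fromℕ {χ = χ} {x} p Ψ = Reach-trans p (Conn-lift x (r-connected χ Ψ))

  module FacetSection (Ψ₀ : Flag × Z2²) where

    x₀ : Z2²
    x₀ = proj₂ Ψ₀

    G : Face (suc n) (Flag × Z2²)
    G = face (fromℕ n) Ψ₀

    S : Face (suc n) (Flag × Z2²) → Set
    S = Pos.Section E G ⊥F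

    Anchored : Fin (suc n) → Flag × Z2² → Set
    Anchored c a = Σ Flag λ χ → Reach E c a (χ , x₀)

    anchor : ∀ {c a} → S (face c a) → Anchored c a
    anchor {c} {a} (_ , _ , (χ , x) , p , q) =
      χ , subst (λ x → Reach E c a (χ , x)) (Reach-fromℕ-keeps-Z2 q) p

    face-π : {c : Fin (suc n)} → View c → Flag → Face n Flag
    face-π (‵inject₁ j) Φ = face j Φ
    face-π ‵fromℕ       _ = ⊤F

    π : Face (suc n) (Flag × Z2²) → Face n Flag
    π ⊥F               = ⊥F
    π (face c (Φ , _)) = face-π (view c) Φ
    π ⊤F               = ⊤F

    lift : Face n Flag → Face (suc n) (Flag × Z2²)
    lift ⊥F         = ⊥F
    lift (face j Φ) = face (inject₁ j) (Φ , x₀)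
    lift ⊤F         = G

    lift-∈ : ∀ K → S (lift K)
    lift-∈ ⊥F         = tt , tt
    lift-∈ (face j Φ) = tt , ≤fromℕ (inject₁ j) , (Φ , x₀) , here , reanchor-fromℕ here Φ
    lift-∈ ⊤F         = tt , ℕ.≤-refl , Ψ₀ , here , here

    π∘lift : ∀ K → π (lift K) ≡ K
    π∘lift ⊥F         = refl
    π∘lift (face j Φ) rewrite view-inject₁ j = refl
    π∘lift ⊤F         rewrite view-fromℕ n   = refl

    π-rank : ∀ {K} → S K → rk (π K) ≡ rk K
    π-rank {⊥F}              _        = refl
    π-rank {⊤F}              (_ , ())
    π-rank {face c (Φ , x)}  _        with view c
    ... | ‵inject₁ j = cong suc (sym (toℕ-inject₁ j))
    ... | ‵fromℕ     = cong suc (sym (toℕ-fromℕ n))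

    fromℕ≰inject₁ : ∀ (j : Fin n) → ¬ (toℕ (fromℕ n) ≤ toℕ (inject₁ j))
    fromℕ≰inject₁ j le = ℕ.<⇒≱ (inject₁ℕ< j) (subst (_≤ toℕ (inject₁ j)) (toℕ-fromℕ n) le)

    π-≈ : ∀ {K L} → FaceEq E K L → FaceEq M (π K) (π L)
    π-≈ {⊥F}             {⊥F}               _        = tt
    π-≈ {⊤F}             {⊤F}               _        = tt
    π-≈ {face c (Φ , _)} {face .c (Ψ , _)} (refl , p) with view c
    ... | ‵inject₁ j = refl , Reach-proj p
    ... | ‵fromℕ     = tt
    π-≈ {⊥F} {face _ _} ()
    π-≈ {⊥F} {⊤F} ()
    π-≈ {face _ _} {⊥F} ()
    π-≈ {face _ _} {⊤F} ()
    π-≈ {⊤F} {⊥F} ()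
    π-≈ {⊤F} {face _ _} ()

    π-≤ : ∀ {K L} → FaceLe E K L → FaceLe M (π K) (π L)
    π-≤ {⊥F}             {_}  _ = tt
    π-≤ {⊤F}             {⊤F} _ = tt
    π-≤ {face c _}       {⊤F} _ with view c
    ... | ‵inject₁ _ = tt
    ... | ‵fromℕ     = tt
    π-≤ {face c (Φ , _)} {face c′ (Ψ , _)} (le , (χ , _) , p , q) with view c | view c′
    ... | ‵inject₁ j | ‵inject₁ j′ =
      subst₂ _≤_ (toℕ-inject₁ j) (toℕ-inject₁ j′) le , χ , Reach-proj p , Reach-proj q
    ... | ‵inject₁ _ | ‵fromℕ      = tt
    ... | ‵fromℕ     | ‵inject₁ j′ = ⊥-elim (fromℕ≰inject₁ j′ le)
    ... | ‵fromℕ     | ‵fromℕ      = tt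
    π-≤ {face _ _} {⊥F} ()
    π-≤ {⊤F} {⊥F} ()
    π-≤ {⊤F} {face _ _} ()

    π-reflects-≈ : ∀ {K L} → S K → S L → FaceEq M (π K) (π L) → FaceEq E K L
    π-reflects-≈ {⊥F} {⊥F} _ _ _ = tt
    π-reflects-≈ {⊤F} (_ , ()) _ _
    π-reflects-≈ {_} {⊤F} _ (_ , ()) _
    π-reflects-≈ {⊥F} {face c _} _ _ e with view c
    π-reflects-≈ {⊥F} {face c _} _ _ () | ‵inject₁ _
    π-reflects-≈ {⊥F} {face c _} _ _ () | ‵fromℕ
    π-reflects-≈ {face c _} {⊥F} _ _ e with view c
    π-reflects-≈ {face c _} {⊥F} _ _ () | ‵inject₁ _
    π-reflects-≈ {face c _} {⊥F} _ _ () | ‵fromℕ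
    π-reflects-≈ {face c (Φ , x)} {face c′ (Ψ , y)} sK sL e
      with anchor sK | anchor sL | view c | view c′
    ... | _ , p | _ , p′ | ‵inject₁ j | ‵inject₁ j′ with e
    ...   | refl , q =
      refl , Reach-trans (reanchor-inject₁ p q) (Reach-sym E-sym (reanchor-inject₁ p′ here))
    π-reflects-≈ {face c (Φ , x)} {face c′ (Ψ , y)} sK sL e
      | _ , p | _ , p′ | ‵fromℕ | ‵fromℕ =
      refl , Reach-trans (reanchor-fromℕ p Ψ) (Reach-sym E-sym (reanchor-fromℕ p′ Ψ))
    π-reflects-≈ {face c (Φ , x)} {face c′ (Ψ , y)} sK sL ()
      | _ | _ | ‵inject₁ _ | ‵fromℕ
    π-reflects-≈ {face c (Φ , x)} {face c′ (Ψ , y)} sK sL ()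
      | _ | _ | ‵fromℕ | ‵inject₁ _

    π-reflects-≤ : ∀ {K L} → S K → S L → FaceLe M (π K) (π L) → FaceLe E K L
    π-reflects-≤ {⊥F} _ _ _ = tt
    π-reflects-≤ {⊤F} (_ , ()) _ _
    π-reflects-≤ {_} {⊤F} _ (_ , ()) _
    π-reflects-≤ {face c _} {⊥F} _ _ le with view c
    π-reflects-≤ {face c _} {⊥F} _ _ () | ‵inject₁ _
    π-reflects-≤ {face c _} {⊥F} _ _ () | ‵fromℕ
    π-reflects-≤ {face c (Φ , x)} {face c′ (Ψ , y)} sK sL le
      with anchor sK | anchor sL | view c | view c′
    ... | _ , p | _ , p′ | ‵inject₁ j | ‵inject₁ j′ with le
    ...   | j≤j′ , χ , q , q′ =
      subst₂ _≤_ (sym (toℕ-inject₁ j)) (sym (toℕ-inject₁ j′)) j≤j′ ,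
      (χ , x₀) , reanchor-inject₁ p q , reanchor-inject₁ p′ q′
    π-reflects-≤ {face c (Φ , x)} {face c′ (Ψ , y)} sK sL le
      | χ , p | _ , p′ | _ | ‵fromℕ =
      ≤fromℕ c , (χ , x₀) , p , reanchor-fromℕ p′ χ
    π-reflects-≤ {face c (Φ , x)} {face c′ (Ψ , y)} sK sL ()
      | _ | _ | ‵fromℕ | ‵inject₁ _

    section≅Pos : DiamondTransfer.RankedIsoOnto (FaceEq E) (FaceLe E) rk
                                                (FaceEq M) (FaceLe M) rk S
    section≅Pos = record
      { π            = π
      ; lift         = lift
      ; lift-∈       = lift-∈
      ; π∘lift       = π∘lift
      ; π-≈          = π-≈
      ; π-≤          = π-≤
      ; π-reflects-≈ = π-reflects-≈
      ; π-reflects-≤ = π-reflects-≤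
      ; π-rank       = π-rank
      }

    diamond : Pos.Diamond M (Pos.Whole M) → Pos.Diamond E S
    diamond = DiamondTransfer.diamond-transfer _ _ _ _ _ _ section≅Pos

mainTheorem3 : (k : ℕ) (Flag : Set) (r : Fin (suc k) → Flag → Flag) →
    IsManiplex (suc k) Flag r → Polytopal (EdgeOf r) →
    (Φ₀ : Flag) (Ψ₀ : Flag × Z2²) →
    Pos.Diamond (MFEdge (suc k) r (InFacet r Φ₀))
      (Pos.Section (MFEdge (suc k) r (InFacet r Φ₀)) (face (fromℕ (suc k)) Ψ₀) ⊥F)
mainTheorem3 k Flag r isM (diamondM , _) Φ₀ Ψ₀ =
  FlagGraphMF.FacetSection.diamond r involutive connected (InFacet r Φ₀) Ψ₀ diamondM
  where open IsManiplex isM
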